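{- Let $\varphi$ be the morphism on the alphabet $\{0, 1, 0', -1\}$ defined by $$0 \mapsto 0\,1\,0'\,{ -1},\quad 1 \mapsto 0\,1\,{ -1}\,1,\quad 0' \mapsto 0'\,{ -1}\,0\,1,\quad { -1} \mapsto 0'\,{ -1}\,1\,{ -1},$$ and let $\tau$ be the letter-to-letter map (coding) with $\tau(0)=\tau(0')=0$, $\tau(1)=1$, $\tau(-1)=-1$. Let $\varphi^\omega(0)$ be the infinite fixed point of $\varphi$ starting with $0$, and $\mathbf{w} = \tau(\varphi^\omega(0))$, an infinite word over $\{ -1,0,1\} \subset \mathbb{Z}$. Then $\mathbf{w}$ is squarefree (contains no factor $xx$ with $x$ nonempty), and $\mathbf{w}$ contains no factor of the form $x x'$ (with $x, x'$ words of arbitrary, possibly different, lengths) such that $\sum x = \sum x' \neq 0$.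
   Context: For a word $x$ over $\mathbb{Z}$, $\sum x$ denotes the sum of its entries. A factor of $\mathbf{w}$ is a contiguous block of consecutive letters. -}

module Defs where

open import Data.Nat using (ℕ; zero; suc; _+_; _*_; _^_; _<_)
open import Data.Nat.DivMod using (_/_; _%_)
open import Data.Fin using (Fin; zero; suc)
open import Data.Integer using (ℤ; +_; -[1+_])
import Data.Integer as ℤ
open import Data.Vec using (Vec; []; _∷_; lookup)

data Letter : Set where
  l0 l1 l0' lm1 : Letter

φ : Letter → Vec Letter 4
φ l0  = l0  ∷ l1  ∷ l0' ∷ lm1 ∷ []
φ l1  = l0  ∷ l1  ∷ lm1 ∷ l1  ∷ []
φ l0' = l0' ∷ lm1 ∷ l0  ∷ l1  ∷ []
φ lm1 = l0' ∷ lm1 ∷ l1  ∷ lm1 ∷ []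

τ : Letter → ℤ
τ l0  = + 0
τ l1  = + 1
τ l0' = + 0
τ lm1 = -[1+ 0 ]

mod4 : ℕ → Fin 4
mod4 0 = zero
mod4 1 = suc zero
mod4 2 = suc (suc zero)
mod4 3 = suc (suc (suc zero))
mod4 (suc (suc (suc (suc n)))) = mod4 n

-- iterLetter k n = the n-th letter (0-indexed) of φ^k(0), meaningful for n < 4^k.
-- Since |φ(a)| = 4, letter n of φ^(k+1)(0) = φ(letter ⌊n/4⌋ of φ^k(0)) at n mod 4.
iterLetter : ℕ → ℕ → Letter
iterLetter zero    n = l0
iterLetter (suc k) n = lookup (φ (iterLetter k (n / 4))) (mod4 n)

-- φ^ω(0): since φ(0) starts with 0, φ^k(0) is a prefix of φ^(k+1)(0),
-- and position n is fixed once n < 4^k; k = n suffices as n < 4^n.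
φω : ℕ → Letter
φω n = iterLetter n n

w : ℕ → ℤ
w n = τ (φω n)

factorSum : ℕ → ℕ → ℤ
factorSum i zero    = + 0
factorSum i (suc m) = w i ℤ.+ factorSum (suc i) m

-- Along φω(0) the height h(0) = h(1) = 0, h(0') = h(-1) = 1 of a letter plus its τ-value is
-- the height of the next letter, so every prefix sum of w is a height, i.e. lies in {0, 1}.
-- Adjacent factors with equal sums s give three prefix sums h, h + s, h + 2s in {0, 1},
-- whence s = 0.
--
-- Let w contain a square of period m starting at position i. If 4 ∣ m, reading w at the
-- positions ≡ 2 (mod 4) gives -w (the third letter of φ(a) has τ-value -τ(a)), which
-- contains a square of period m / 4; descend. If 4 ∤ m, both halves of the square lie in
-- images τ(φ(u)) of words u whose consecutive letters are two-letter factors of φω(0), and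
-- a finite check over all such u excludes m < 8 directly, and for m > 8 shows that two
-- images shifted by m mod 4 already disagree within six positions.

module Submission where

open import Defs
open import Data.Nat using (ℕ; zero; suc; _+_; _*_; _^_; _<_; _≤_; _≤′_; ≤′-refl; ≤′-step; z≤n; s≤s; z<s)
open import Data.Nat.Properties
open import Data.Nat.DivMod using (_/_; _divMod_; result; m<n⇒m/n≡0; m*n/n≡m; +-distrib-/-∣ʳ; m<n*o⇒m/o<n)
open import Data.Nat.Divisibility using (divides-refl)
open import Data.Nat.Induction using (<-rec)
open import Data.Nat.Solver using (module +-*-Solver)
open +-*-Solver using (solve; _:=_; _:+_; _:*_; con)
open import Data.Integer using (ℤ; +_; -[1+_]; 0ℤ; 1ℤ; -_) renaming (_+_ to _+ℤ_; _≟_ to _≟ℤ_)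
import Data.Integer.Properties as ℤ
open import Data.Fin using (Fin; zero; suc; toℕ; inject₁; fromℕ)
open import Data.Fin.Properties using (toℕ<n; all?; any?)
open import Data.Vec using (lookup)
open import Data.List using (List; []; _∷_; [_]; map; concatMap)
open import Data.List.Membership.Propositional using (_∈_)
open import Data.List.Membership.Propositional.Properties using (∈-map⁺; ∈-concatMap⁺)
open import Data.List.Relation.Unary.Any using (here; there)
import Data.List.Relation.Unary.Any as Any
open import Data.List.Relation.Unary.All using (All)
import Data.List.Relation.Unary.All as All
open import Data.Product using (_×_; _,_; ∃-syntax)
open import Data.Sum using (inj₁; inj₂)
open import Relation.Binary.PropositionalEquality
  using (_≡_; _≢_; refl; sym; trans; cong; cong₂; subst; subst₂; module ≡-Reasoning)
open import Relation.Nullary using (¬_; Dec; ¬?)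
open import Relation.Nullary.Decidable using (toWitness)

iterLetter-suc : ∀ k n → n < 4 ^ k → iterLetter (suc k) n ≡ iterLetter k n
iterLetter-suc zero    zero    _         = refl
iterLetter-suc zero    (suc n) (s≤s ())
iterLetter-suc (suc k) n       n<4^[1+k] = cong (λ a → lookup (φ a) (mod4 n))
  (iterLetter-suc k (n / 4) (m<n*o⇒m/o<n (subst (n <_) (*-comm 4 (4 ^ k)) n<4^[1+k])))

iterLetter-stable : ∀ {k l} n → k ≤′ l → n < 4 ^ k → iterLetter l n ≡ iterLetter k n
iterLetter-stable n ≤′-refl                _     = refl
iterLetter-stable n (≤′-step {n = l} k≤′l) n<4^k =
  trans (iterLetter-suc l n (<-≤-trans n<4^k (^-monoʳ-≤ 4 (≤′⇒≤ k≤′l))))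
        (iterLetter-stable n k≤′l n<4^k)

iterLetter-agree : ∀ k l n → n < 4 ^ k → n < 4 ^ l → iterLetter k n ≡ iterLetter l n
iterLetter-agree k l n n<4^k n<4^l with ≤-total k l
... | inj₁ k≤l = sym (iterLetter-stable n (≤⇒≤′ k≤l) n<4^k)
... | inj₂ l≤k = iterLetter-stable n (≤⇒≤′ l≤k) n<4^l

n<b^n : ∀ {b} → 1 < b → ∀ n → n < b ^ n
n<b^n {suc b} _   zero    = z<s
n<b^n {suc b} 1<b (suc n) = ≤-trans (s≤s (n<b^n 1<b n))
  (≤-trans (m<m*n (suc b ^ n) (suc b) ⦃ m^n≢0 (suc b) n ⦄ 1<b)
           (≤-reflexive (*-comm (suc b ^ n) (suc b))))

mod4-block : ∀ (r : Fin 4) q → mod4 (toℕ r + q * 4) ≡ r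
mod4-block zero                   zero    = refl
mod4-block zero                   (suc q) = mod4-block zero q
mod4-block (suc zero)             zero    = refl
mod4-block (suc zero)             (suc q) = mod4-block (suc zero) q
mod4-block (suc (suc zero))       zero    = refl
mod4-block (suc (suc zero))       (suc q) = mod4-block (suc (suc zero)) q
mod4-block (suc (suc (suc zero))) zero    = refl
mod4-block (suc (suc (suc zero))) (suc q) = mod4-block (suc (suc (suc zero))) q

div4-block : ∀ (r : Fin 4) q → (toℕ r + q * 4) / 4 ≡ q
div4-block r q = begin
  (toℕ r + q * 4) / 4   ≡⟨ +-distrib-/-∣ʳ (toℕ r) (divides-refl q) ⟩
  toℕ r / 4 + q * 4 / 4 ≡⟨ cong₂ _+_ (m<n⇒m/n≡0 (toℕ<n r)) (m*n/n≡m q 4) ⟩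
  q                     ∎
  where open ≡-Reasoning

φω-block : ∀ q (r : Fin 4) → φω (toℕ r + q * 4) ≡ lookup (φ (φω q)) r
φω-block q r = begin
  iterLetter n n                             ≡⟨ iterLetter-agree n (suc q) n (n<b^n 1<4 n) n<4^[1+q] ⟩
  lookup (φ (iterLetter q (n / 4))) (mod4 n) ≡⟨ cong₂ (λ m i → lookup (φ (iterLetter q m)) i)
                                                      (div4-block r q) (mod4-block r q) ⟩
  lookup (φ (φω q)) r                        ∎
  where
  open ≡-Reasoning
  n = toℕ r + q * 4
  1<4 : 1 < 4
  1<4 = s≤s (s≤s z≤n)
  n<4^[1+q] : n < 4 ^ suc q
  n<4^[1+q] = <-≤-trans (+-monoˡ-< (q * 4) (toℕ<n r))
    (≤-trans (*-monoˡ-≤ 4 (n<b^n 1<4 q)) (≤-reflexive (*-comm (4 ^ q) 4)))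

infix 4 _↝_

data _↝_ : Letter → Letter → Set where
  l0↝l1   : l0  ↝ l1
  l1↝l0'  : l1  ↝ l0'
  l1↝lm1  : l1  ↝ lm1
  l0'↝lm1 : l0' ↝ lm1
  lm1↝l0  : lm1 ↝ l0
  lm1↝l1  : lm1 ↝ l1

φ-adjacent-within : ∀ a (r : Fin 3) → lookup (φ a) (inject₁ r) ↝ lookup (φ a) (suc r)
φ-adjacent-within l0  zero             = l0↝l1
φ-adjacent-within l0  (suc zero)       = l1↝l0'
φ-adjacent-within l0  (suc (suc zero)) = l0'↝lm1
φ-adjacent-within l1  zero             = l0↝l1
φ-adjacent-within l1  (suc zero)       = l1↝lm1
φ-adjacent-within l1  (suc (suc zero)) = lm1↝l1
φ-adjacent-within l0' zero             = l0'↝lm1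
φ-adjacent-within l0' (suc zero)       = lm1↝l0
φ-adjacent-within l0' (suc (suc zero)) = l0↝l1
φ-adjacent-within lm1 zero             = l0'↝lm1
φ-adjacent-within lm1 (suc zero)       = lm1↝l1
φ-adjacent-within lm1 (suc (suc zero)) = l1↝lm1

φ-adjacent-across : ∀ {a b} → a ↝ b → lookup (φ a) (fromℕ 3) ↝ lookup (φ b) zero
φ-adjacent-across l0↝l1   = lm1↝l0
φ-adjacent-across l1↝l0'  = l1↝l0'
φ-adjacent-across l1↝lm1  = l1↝l0'
φ-adjacent-across l0'↝lm1 = l1↝l0'
φ-adjacent-across lm1↝l0  = lm1↝l0
φ-adjacent-across lm1↝l1  = lm1↝l0

φω-adjacent : ∀ n → φω n ↝ φω (suc n)
φω-adjacent = <-rec _ adjacent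
  where
  within : ∀ q (r : Fin 3) → φω (toℕ (inject₁ r) + q * 4) ↝ φω (toℕ (suc r) + q * 4)
  within q r = subst₂ _↝_ (sym (φω-block q (inject₁ r))) (sym (φω-block q (suc r)))
                          (φ-adjacent-within (φω q) r)

  adjacent : ∀ n → (∀ {m} → m < n → φω m ↝ φω (suc m)) → φω n ↝ φω (suc n)
  adjacent n rec with n divMod 4
  ... | result q zero                   refl = within q zero
  ... | result q (suc zero)             refl = within q (suc zero)
  ... | result q (suc (suc zero))       refl = within q (suc (suc zero))
  ... | result q (suc (suc (suc zero))) refl =
    subst₂ _↝_ (sym (φω-block q (fromℕ 3))) (sym (φω-block (suc q) zero))
               (φ-adjacent-across (rec (s≤s (≤-trans (m≤m*n q 4) (m≤n+m (q * 4) 2)))))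

height : Letter → ℤ
height l0  = 0ℤ
height l1  = 0ℤ
height l0' = 1ℤ
height lm1 = 1ℤ

height-step : ∀ {a b} → a ↝ b → height a +ℤ τ a ≡ height b
height-step l0↝l1   = refl
height-step l1↝l0'  = refl
height-step l1↝lm1  = refl
height-step l0'↝lm1 = refl
height-step lm1↝l0  = refl
height-step lm1↝l1  = refl

factorSum-+ : ∀ i a b → factorSum i (a + b) ≡ factorSum i a +ℤ factorSum (i + a) b
factorSum-+ i zero    b rewrite +-identityʳ i = sym (ℤ.+-identityˡ _)
factorSum-+ i (suc a) b rewrite +-suc i a =
  trans (cong (w i +ℤ_) (factorSum-+ (suc i) a b)) (sym (ℤ.+-assoc (w i) _ _))

prefixSum≡height : ∀ n → factorSum 0 n ≡ height (φω n)
prefixSum≡height zero    = refl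
prefixSum≡height (suc n) = begin
  factorSum 0 (suc n)           ≡⟨ cong (factorSum 0) (+-comm 1 n) ⟩
  factorSum 0 (n + 1)           ≡⟨ factorSum-+ 0 n 1 ⟩
  factorSum 0 n +ℤ (w n +ℤ 0ℤ)  ≡⟨ cong₂ _+ℤ_ (prefixSum≡height n) (ℤ.+-identityʳ (w n)) ⟩
  height (φω n) +ℤ τ (φω n)     ≡⟨ height-step (φω-adjacent n) ⟩
  height (φω (suc n))           ∎
  where open ≡-Reasoning

height-+-factorSum : ∀ i a → height (φω i) +ℤ factorSum i a ≡ height (φω (i + a))
height-+-factorSum i a = begin
  height (φω i) +ℤ factorSum i a  ≡⟨ cong (_+ℤ factorSum i a) (prefixSum≡height i) ⟨
  factorSum 0 i +ℤ factorSum i a  ≡⟨ factorSum-+ 0 i a ⟨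
  factorSum 0 (i + a)             ≡⟨ prefixSum≡height (i + a) ⟩
  height (φω (i + a))             ∎
  where open ≡-Reasoning

data Bit : ℤ → Set where
  bit0 : Bit 0ℤ
  bit1 : Bit 1ℤ

height-bit : ∀ a → Bit (height a)
height-bit l0  = bit0
height-bit l1  = bit0
height-bit l0' = bit1
height-bit lm1 = bit1

repeated-bit-step≡0 : ∀ {x y z s} → Bit x → Bit y → Bit z → x +ℤ s ≡ y → y +ℤ s ≡ z → s ≡ 0ℤ
repeated-bit-step≡0 {s = + zero}           _    _    _    _    _ = refl
repeated-bit-step≡0 {s = + suc _}          bit0 bit0 _    ()   _
repeated-bit-step≡0 {s = + suc _}          bit1 bit0 _    ()   _
repeated-bit-step≡0 {s = + suc _}          bit1 bit1 _    ()   _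
repeated-bit-step≡0 {s = + suc _}          bit0 bit1 bit0 refl ()
repeated-bit-step≡0 {s = + suc _}          bit0 bit1 bit1 refl ()
repeated-bit-step≡0 {s = -[1+ _ ]}         bit0 bit0 _    ()   _
repeated-bit-step≡0 {s = -[1+ _ ]}         bit0 bit1 _    ()   _
repeated-bit-step≡0 {s = -[1+ suc _ ]}     bit1 bit0 _    ()   _
repeated-bit-step≡0 {s = -[1+ suc _ ]}     bit1 bit1 _    ()   _
repeated-bit-step≡0 {s = -[1+ zero ]}      bit1 bit0 bit0 refl ()
repeated-bit-step≡0 {s = -[1+ zero ]}      bit1 bit0 bit1 refl ()

equal-adjacent-sums⇒0 : ∀ i a b → factorSum i a ≡ factorSum (i + a) b → factorSum i a ≡ 0ℤ
equal-adjacent-sums⇒0 i a b eq =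
  repeated-bit-step≡0 (height-bit (φω i)) (height-bit (φω (i + a))) (height-bit (φω (i + a + b)))
    (height-+-factorSum i a)
    (trans (cong (height (φω (i + a)) +ℤ_) eq) (height-+-factorSum (i + a) b))

window : ℕ → ℕ → List Letter
window q zero    = []
window q (suc k) = φω q ∷ window (suc q) k

-- τ(φ(ys)) by position, 0 past its end
τφ : List Letter → ℕ → ℤ
τφ []       _                         = 0ℤ
τφ (y ∷ _)  0                         = τ (lookup (φ y) zero)
τφ (y ∷ _)  1                         = τ (lookup (φ y) (suc zero))
τφ (y ∷ _)  2                         = τ (lookup (φ y) (suc (suc zero)))
τφ (y ∷ _)  3                         = τ (lookup (φ y) (suc (suc (suc zero))))
τφ (_ ∷ ys) (suc (suc (suc (suc p)))) = τφ ys p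

w-window : ∀ k q p → p < k * 4 → w (p + q * 4) ≡ τφ (window q k) p
w-window (suc k) q 0 _ = cong τ (φω-block q zero)
w-window (suc k) q 1 _ = cong τ (φω-block q (suc zero))
w-window (suc k) q 2 _ = cong τ (φω-block q (suc (suc zero)))
w-window (suc k) q 3 _ = cong τ (φω-block q (suc (suc (suc zero))))
w-window (suc k) q (suc (suc (suc (suc p)))) (s≤s (s≤s (s≤s (s≤s p<4k)))) =
  trans (cong w (trans (cong (_+ q * 4) (+-comm 4 p)) (+-assoc p 4 (q * 4))))
        (w-window k (suc q) p p<4k)

letters : List Letter
letters = l0 ∷ l1 ∷ l0' ∷ lm1 ∷ []

∈-letters : ∀ a → a ∈ letters
∈-letters l0  = here refl
∈-letters l1  = there (here refl)
∈-letters l0' = there (there (here refl))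
∈-letters lm1 = there (there (there (here refl)))

successors : Letter → List Letter
successors l0  = l1 ∷ []
successors l1  = l0' ∷ lm1 ∷ []
successors l0' = lm1 ∷ []
successors lm1 = l0 ∷ l1 ∷ []

↝⇒∈-successors : ∀ {a b} → a ↝ b → b ∈ successors a
↝⇒∈-successors l0↝l1   = here refl
↝⇒∈-successors l1↝l0'  = here refl
↝⇒∈-successors l1↝lm1  = there (here refl)
↝⇒∈-successors l0'↝lm1 = here refl
↝⇒∈-successors lm1↝l0  = here refl
↝⇒∈-successors lm1↝l1  = there (here refl)

walksFrom : Letter → ℕ → List (List Letter)
walksFrom a zero    = [ [ a ] ]
walksFrom a (suc k) = concatMap (λ b → map (a ∷_) (walksFrom b k)) (successors a)

walks : ℕ → List (List Letter)
walks k = concatMap (λ a → walksFrom a k) letters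

window-∈-walksFrom : ∀ q k → window q (suc k) ∈ walksFrom (φω q) k
window-∈-walksFrom q zero    = here refl
window-∈-walksFrom q (suc k) = ∈-concatMap⁺ (λ b → map (φω q ∷_) (walksFrom b k))
  (Any.map (λ { refl → ∈-map⁺ (φω q ∷_) (window-∈-walksFrom (suc q) k) })
           (↝⇒∈-successors (φω-adjacent q)))

window-∈-walks : ∀ q k → window q (suc k) ∈ walks k
window-∈-walks q k = ∈-concatMap⁺ (λ a → walksFrom a k)
  (Any.map (λ { refl → window-∈-walksFrom q k }) (∈-letters (φω q)))

DifferBelow : ℕ → (ℕ → ℤ) → (ℕ → ℤ) → Set
DifferBelow n f g = ∃[ j ] f (toℕ {n} j) ≢ g (toℕ j)

differBelow? : ∀ n f g → Dec (DifferBelow n f g)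
differBelow? n f g = any? λ j → ¬? (f (toℕ j) ≟ℤ g (toℕ j))

-- m runs over the periods below 8 that are not multiples of 4
NoShortSquares : List Letter → Set
NoShortSquares ys = ∀ (r : Fin 4) (o : Fin 3) (t : Fin 2) →
  let m = suc (toℕ o) + toℕ t * 4 in
  DifferBelow m (λ j → τφ ys (toℕ r + j)) (λ j → τφ ys (toℕ r + m + j))

Desynchronized : List Letter → List Letter → Set
Desynchronized ys zs = ∀ (r : Fin 4) (o : Fin 3) →
  DifferBelow 6 (λ j → τφ ys (toℕ r + j)) (λ j → τφ zs (toℕ r + j + suc (toℕ o)))

noShortSquares? : ∀ ys → Dec (NoShortSquares ys)
noShortSquares? ys = all? λ r → all? λ o → all? λ t →
  let m = suc (toℕ o) + toℕ t * 4 in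
  differBelow? m (λ j → τφ ys (toℕ r + j)) (λ j → τφ ys (toℕ r + m + j))

desynchronized? : ∀ ys zs → Dec (Desynchronized ys zs)
desynchronized? ys zs = all? λ r → all? λ o →
  differBelow? 6 (λ j → τφ ys (toℕ r + j)) (λ j → τφ zs (toℕ r + j + suc (toℕ o)))

no-short-squares : All NoShortSquares (walks 4)
no-short-squares = toWitness {a? = All.all? noShortSquares? (walks 4)} _

desynchronized : All (λ ys → All (Desynchronized ys) (walks 2)) (walks 2)
desynchronized =
  toWitness {a? = All.all? (λ ys → All.all? (desynchronized? ys) (walks 2)) (walks 2)} _

Square : ℕ → ℕ → Set
Square i m = ∀ j → j < m → w (i + j) ≡ w (i + m + j)

τ-φ-third : ∀ a → τ (lookup (φ a) (suc (suc zero))) ≡ - τ a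
τ-φ-third l0  = refl
τ-φ-third l1  = refl
τ-φ-third l0' = refl
τ-φ-third lm1 = refl

w-third : ∀ n → w (2 + n * 4) ≡ - w n
w-third n = trans (cong τ (φω-block n (suc (suc zero)))) (τ-φ-third (φω n))

square-descent : ∀ i {t} q₀ (c : Fin 4) → i + toℕ c ≡ 2 + q₀ * 4 →
                 Square i (t * 4) → Square q₀ t
square-descent i {t} q₀ c i+c≡2+4q₀ sq j j<t = ℤ.neg-injective (begin
  - w (q₀ + j)                      ≡⟨ w-third (q₀ + j) ⟨
  w (2 + (q₀ + j) * 4)              ≡⟨ cong w (sample j) ⟨
  w (i + (toℕ c + j * 4))           ≡⟨ sq (toℕ c + j * 4) c+4j<4t ⟩
  w (i + t * 4 + (toℕ c + j * 4))   ≡⟨ cong w (trans shift (sample (t + j))) ⟩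
  w (2 + (q₀ + (t + j)) * 4)        ≡⟨ cong (λ x → w (2 + x * 4)) (+-assoc q₀ t j) ⟨
  w (2 + (q₀ + t + j) * 4)          ≡⟨ w-third (q₀ + t + j) ⟩
  - w (q₀ + t + j)                  ∎)
  where
  open ≡-Reasoning
  c+4j<4t : toℕ c + j * 4 < t * 4
  c+4j<4t = <-≤-trans (+-monoˡ-< (j * 4) (toℕ<n c)) (*-monoˡ-≤ 4 j<t)
  sample : ∀ x → i + (toℕ c + x * 4) ≡ 2 + (q₀ + x) * 4
  sample x = begin
    i + (toℕ c + x * 4)   ≡⟨ +-assoc i (toℕ c) (x * 4) ⟨
    i + toℕ c + x * 4     ≡⟨ cong (_+ x * 4) i+c≡2+4q₀ ⟩
    2 + q₀ * 4 + x * 4    ≡⟨ +-assoc 2 (q₀ * 4) (x * 4) ⟩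
    2 + (q₀ * 4 + x * 4)  ≡⟨ cong (λ y → 2 + y) (*-distribʳ-+ 4 q₀ x) ⟨
    2 + (q₀ + x) * 4      ∎
  shift : i + t * 4 + (toℕ c + j * 4) ≡ i + (toℕ c + (t + j) * 4)
  shift = solve 4 (λ i t c j → i :+ t :* con 4 :+ (c :+ j :* con 4) := i :+ (c :+ (t :+ j) :* con 4))
                refl i t (toℕ c) j

square-period×4 : ∀ q (r : Fin 4) t → Square (toℕ r + q * 4) (t * 4) → ∃[ q₀ ] Square q₀ t
square-period×4 q zero                   t sq =
  q , square-descent (q * 4) q (suc (suc zero)) (+-comm (q * 4) 2) sq
square-period×4 q (suc zero)             t sq =
  q , square-descent (1 + q * 4) q (suc zero) (cong suc (+-comm (q * 4) 1)) sq
square-period×4 q (suc (suc zero))       t sq =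
  q , square-descent (2 + q * 4) q zero (+-identityʳ (2 + q * 4)) sq
square-period×4 q (suc (suc (suc zero))) t sq =
  suc q , square-descent (3 + q * 4) (suc q) (suc (suc (suc zero))) (cong (λ x → 3 + x) (+-comm (q * 4) 3)) sq

+-block : ∀ r q x → r + q * 4 + x ≡ r + x + q * 4
+-block r q x = begin
  r + q * 4 + x    ≡⟨ +-assoc r (q * 4) x ⟩
  r + (q * 4 + x)  ≡⟨ cong (λ y → r + y) (+-comm (q * 4) x) ⟩
  r + (x + q * 4)  ≡⟨ +-assoc r x (q * 4) ⟨
  r + x + q * 4    ∎
  where open ≡-Reasoning

short-period-not-square : ∀ q (r : Fin 4) (o : Fin 3) (t : Fin 2) → NoShortSquares (window q 5) →
                          ¬ Square (toℕ r + q * 4) (suc (toℕ o) + toℕ t * 4)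
short-period-not-square q r o t no-squares sq with no-squares r o t
... | j , differ = differ (begin
  τφ (window q 5) (toℕ r + toℕ j)      ≡⟨ w-window 5 q _ r+j<20 ⟨
  w (toℕ r + toℕ j + q * 4)            ≡⟨ cong w (+-block (toℕ r) q (toℕ j)) ⟨
  w (toℕ r + q * 4 + toℕ j)            ≡⟨ sq (toℕ j) (toℕ<n j) ⟩
  w (toℕ r + q * 4 + m + toℕ j)        ≡⟨ cong w (trans (cong (_+ toℕ j) (+-block (toℕ r) q m))
                                                         (+-block (toℕ r + m) q (toℕ j))) ⟩
  w (toℕ r + m + toℕ j + q * 4)        ≡⟨ w-window 5 q _ r+m+j<20 ⟩
  τφ (window q 5) (toℕ r + m + toℕ j)  ∎)
  where
  open ≡-Reasoning
  m = suc (toℕ o) + toℕ t * 4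
  m≤7 : m ≤ 7
  m≤7 = +-mono-≤ (toℕ<n o) (*-monoˡ-≤ 4 (≤-pred (toℕ<n t)))
  r+m+j<20 : toℕ r + m + toℕ j < 20
  r+m+j<20 = ≤-trans (s≤s (+-mono-≤ (+-mono-≤ (≤-pred (toℕ<n r)) m≤7) (≤-pred (≤-trans (toℕ<n j) m≤7))))
                     (≤ᵇ⇒≤ 17 20 _)
  r+j<20 : toℕ r + toℕ j < 20
  r+j<20 = ≤-<-trans (+-monoˡ-≤ (toℕ j) (m≤m+n (toℕ r) m)) r+m+j<20

long-period-not-square : ∀ q (r : Fin 4) (o : Fin 3) t →
                         Desynchronized (window q 3) (window (q + suc (suc t)) 3) →
                         ¬ Square (toℕ r + q * 4) (suc (toℕ o) + suc (suc t) * 4)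
long-period-not-square q r o t desync sq with desync r o
... | j , differ = differ (begin
  τφ (window q 3) (toℕ r + toℕ j)                  ≡⟨ w-window 3 q _ r+j<12 ⟨
  w (toℕ r + toℕ j + q * 4)                        ≡⟨ cong w (+-block (toℕ r) q (toℕ j)) ⟨
  w (toℕ r + q * 4 + toℕ j)                        ≡⟨ sq (toℕ j) j<m ⟩
  w (toℕ r + q * 4 + m + toℕ j)                    ≡⟨ cong w shift ⟩
  w (toℕ r + toℕ j + suc (toℕ o) + q′ * 4)         ≡⟨ w-window 3 q′ _ r+j+s<12 ⟩
  τφ (window q′ 3) (toℕ r + toℕ j + suc (toℕ o))   ∎)
  where
  open ≡-Reasoning
  m = suc (toℕ o) + suc (suc t) * 4
  q′ = q + suc (suc t)
  j<m : toℕ j < m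
  j<m = <-≤-trans (toℕ<n j) (≤-trans (≤ᵇ⇒≤ 6 8 _) (≤-trans (m≤m+n 8 (t * 4)) (m≤n+m _ (suc (toℕ o)))))
  r+j+s<12 : toℕ r + toℕ j + suc (toℕ o) < 12
  r+j+s<12 = s≤s (+-mono-≤ (+-mono-≤ (≤-pred (toℕ<n r)) (≤-pred (toℕ<n j))) (toℕ<n o))
  r+j<12 : toℕ r + toℕ j < 12
  r+j<12 = ≤-<-trans (m≤m+n (toℕ r + toℕ j) (suc (toℕ o))) r+j+s<12
  shift : toℕ r + q * 4 + m + toℕ j ≡ toℕ r + toℕ j + suc (toℕ o) + q′ * 4
  shift = solve 5 (λ r q o t j → r :+ q :* con 4 :+ (con 1 :+ o :+ (con 2 :+ t) :* con 4) :+ j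
                                := r :+ j :+ (con 1 :+ o) :+ (q :+ (con 2 :+ t)) :* con 4)
                  refl (toℕ r) q (toℕ o) t (toℕ j)

squarefree : ∀ m i → 1 ≤ m → ¬ Square i m
squarefree = <-rec _ no-square
  where
  short : ∀ q → NoShortSquares (window q 5)
  short q = All.lookup no-short-squares (window-∈-walks q 4)

  desync : ∀ q q′ → Desynchronized (window q 3) (window q′ 3)
  desync q q′ = All.lookup (All.lookup desynchronized (window-∈-walks q 2)) (window-∈-walks q′ 2)

  no-square : ∀ m → (∀ {m′} → m′ < m → ∀ i → 1 ≤ m′ → ¬ Square i m′) →
              ∀ i → 1 ≤ m → ¬ Square i m
  no-square m rec i 1≤m with m divMod 4 | i divMod 4
  ... | result zero          zero    refl | _               = λ _ → n≮0 1≤m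
  ... | result (suc t)       zero    refl | result q r refl = λ sq →
    let q₀ , sq′ = square-period×4 q r (suc t) sq
    in rec (m<m*n (suc t) 4 (s≤s (s≤s z≤n))) q₀ (s≤s z≤n) sq′
  ... | result zero          (suc o) refl | result q r refl =
    short-period-not-square q r o zero (short q)
  ... | result (suc zero)    (suc o) refl | result q r refl =
    short-period-not-square q r o (suc zero) (short q)
  ... | result (suc (suc t)) (suc o) refl | result q r refl =
    long-period-not-square q r o t (desync q (q + suc (suc t)))

theorem5 : (¬ (∃[ i ] ∃[ m ] (1 ≤ m × (∀ j → j < m → w (i + j) ≡ w (i + m + j)))))
    ×
    (¬ (∃[ i ] ∃[ a ] ∃[ b ] (factorSum i a ≡ factorSum (i + a) b × factorSum i a ≢ + 0)))
theorem5 = (λ (i , m , 1≤m , sq) → squarefree m i 1≤m sq)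
         , (λ (i , a , b , eq , sum≢0) → sum≢0 (equal-adjacent-sums⇒0 i a b eq))
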